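{- For all positive integers $r\ge2$, $t\ge2$ and $n$ there exists an $r$-uniform hypergraph $H=(V,E)$ with $|V|=n$ and \[ \delta_{r-1}(H)\ge\frac{n}{(r-1)t+1}-1 \] that has no $t$-shallow hitting edge set.
   Context: A hypergraph $H=(V,E)$ has a finite vertex set and a finite multiset of edges (subsets of $V$); it is $r$-uniform if each edge has $r$ vertices. For an $(r-1)$-set $\hat e\subseteq V$, $N_{r-1}(\hat e)$ is the set of vertices $v$ such that $\hat e\cup\{v\}$ is an edge of $H$, and $\delta_{r-1}(H)$ is the minimum of $|N_{r-1}(\hat e)|$ over all $(r-1)$-subsets $\hat e$ of $V$. For $M\subseteq E$, $\deg_M(v)$ is the number of edges of $M$ containing $v$; $M$ is hitting if $\deg_M(v)\ge1$ for all $v$, and $t$-shallow if $\deg_M(v)\le t$ for all $v$. -}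

module Defs where

open import Data.Nat using (ℕ; _≤_; _∸_; _+_; _*_)
open import Data.Bool using (Bool)
open import Data.Fin using (Fin)
open import Data.Fin.Subset using (Subset; ∣_∣; _∪_; ⁅_⁆; _∈_; _∉_)
open import Data.Fin.Subset.Properties using (_∈?_)
open import Data.List using (List; length; filter; allFin)
open import Data.List.Relation.Unary.All using (All)
open import Data.List.Relation.Unary.Any using (Any; any?)
import Data.List.Relation.Binary.Sublist.Propositional as SubL
open import Data.Vec.Properties using (≡-dec)
import Data.Bool.Properties as BoolP
open import Relation.Binary.PropositionalEquality using (_≡_)
open import Relation.Nullary using (Dec)

record Hypergraph (n : ℕ) : Set where
  constructor hypergraph
  field
    edges : List (Subset n)
open Hypergraph public

Uniform : ∀ {n} → ℕ → Hypergraph n → Set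
Uniform r H = All (λ e → ∣ e ∣ ≡ r) (edges H)

_≟ₛ_ : ∀ {n} → (A B : Subset n) → Dec (A ≡ B)
_≟ₛ_ = ≡-dec BoolP._≟_

-- N_{r-1}(ê) : the vertices v such that ê ∪ {v} is an edge of H
-- (given as the list of such v in increasing order; its length is |N(ê)|).
Nbhd : ∀ {n} → Hypergraph n → Subset n → List (Fin n)
Nbhd H ê = filter (λ v → any? (λ e → e ≟ₛ (ê ∪ ⁅ v ⁆)) (edges H)) (allFin _)

codeg : ∀ {n} → Hypergraph n → Subset n → ℕ
codeg H ê = length (Nbhd H ê)

deg : ∀ {n} → List (Subset n) → Fin n → ℕ
deg M v = length (filter (λ e → v ∈? e) M)

-- M ⊆ E as multisets: M is a sublist of the edge list E.
EdgeSubset : ∀ {n} → List (Subset n) → Hypergraph n → Set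
EdgeSubset M H = SubL._⊆_ M (edges H)

Hitting : ∀ {n} → List (Subset n) → Set
Hitting {n} M = (v : Fin n) → 1 ≤ deg M v

Shallow : ∀ {n} → ℕ → List (Subset n) → Set
Shallow {n} t M = (v : Fin n) → deg M v ≤ t

-- Put k = (r-1)t + 1, fix a set A of a = ⌊(n-1)/k⌋ vertices and take as edges all r-sets
-- meeting A. An (r-1)-set disjoint from A extends by every vertex of A, one meeting A by
-- every vertex outside it, which gives the codegree bound. An edge has at most r-1 vertices
-- outside A for each of its vertices in A, so double counting gives, for a t-shallow hitting
-- edge set M,  n - a ≤ Σ_{e ∈ M} |e ∖ A| ≤ (r-1) Σ_{e ∈ M} |e ∩ A| ≤ (r-1) a t,
-- i.e. n ≤ a k, contradicting the choice of a.
module Submission where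

open import Defs
open import Data.Bool using (true; false; if_then_else_)
open import Data.Empty using (⊥-elim)
open import Data.Fin using (Fin; zero; suc)
open import Data.Fin.Subset
open import Data.Fin.Subset.Properties
open import Data.List using (List; []; _∷_; filter; length; tabulate; map; _++_)
open import Data.List.Membership.Propositional.Properties using (∈-filter⁺; ∈-map⁺; ∈-++⁺ˡ; ∈-++⁺ʳ)
import Data.List.Membership.Propositional as List
open import Data.List.Relation.Binary.Sublist.Propositional.Properties using (All-resp-⊆)
open import Data.List.Relation.Unary.All as All using (All; []; _∷_)
open import Data.List.Relation.Unary.All.Properties using (all-filter)
import Data.List.Relation.Unary.Any as Any
open import Data.Nat
open import Data.Nat.DivMod using (_/_; _%_; m≡m%n+[m/n]*n; m%n<n)
open import Data.Nat.ListAction using (sum)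
open import Data.Nat.Properties
open import Data.Nat.Tactic.RingSolver using (solve-∀)
open import Data.Product using (Σ; _×_; _,_; proj₁; proj₂)
open import Data.Sum using (inj₂)
open import Data.Vec using ([]; _∷_; here; there)
open import Function using (id; _∘_)
open import Level using (0ℓ)
open import Relation.Binary.PropositionalEquality
open import Relation.Nullary using (¬_; does; yes; no)
open import Relation.Nullary.Decidable using (_×-dec_)
open import Relation.Unary using (Pred; Decidable)

private
  variable
    n : ℕ

nonempty⇒∣p∣>0 : {p : Subset n} → Nonempty p → 0 < ∣ p ∣
nonempty⇒∣p∣>0 {n} {p} (x , x∈p) = subst (_< ∣ p ∣) (∣⊥∣≡0 n) (p⊂q⇒∣p∣<∣q∣ (⊥⊆ , x , x∈p , ∉⊥))

x∉p⇒∣p∪⁅x⁆∣≡1+∣p∣ : (p : Subset n) (x : Fin n) → x ∉ p → ∣ p ∪ ⁅ x ⁆ ∣ ≡ suc ∣ p ∣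
x∉p⇒∣p∪⁅x⁆∣≡1+∣p∣ (true ∷ p)  zero    x∉p = ⊥-elim (x∉p here)
x∉p⇒∣p∪⁅x⁆∣≡1+∣p∣ (false ∷ p) zero    x∉p = cong (suc ∘ ∣_∣) (∪-identityʳ p)
x∉p⇒∣p∪⁅x⁆∣≡1+∣p∣ (true ∷ p)  (suc x) x∉p = cong suc (x∉p⇒∣p∪⁅x⁆∣≡1+∣p∣ p x (x∉p ∘ there))
x∉p⇒∣p∪⁅x⁆∣≡1+∣p∣ (false ∷ p) (suc x) x∉p = x∉p⇒∣p∪⁅x⁆∣≡1+∣p∣ p x (x∉p ∘ there)

∣p∩q∣+∣p∩∁q∣≡∣p∣ : (p q : Subset n) → ∣ p ∩ q ∣ + ∣ p ∩ ∁ q ∣ ≡ ∣ p ∣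
∣p∩q∣+∣p∩∁q∣≡∣p∣ []          []          = refl
∣p∩q∣+∣p∩∁q∣≡∣p∣ (true ∷ p)  (true ∷ q)  = cong suc (∣p∩q∣+∣p∩∁q∣≡∣p∣ p q)
∣p∩q∣+∣p∩∁q∣≡∣p∣ (true ∷ p)  (false ∷ q) = trans (+-suc _ _) (cong suc (∣p∩q∣+∣p∩∁q∣≡∣p∣ p q))
∣p∩q∣+∣p∩∁q∣≡∣p∣ (false ∷ p) (true ∷ q)  = ∣p∩q∣+∣p∩∁q∣≡∣p∣ p q
∣p∩q∣+∣p∩∁q∣≡∣p∣ (false ∷ p) (false ∷ q) = ∣p∩q∣+∣p∩∁q∣≡∣p∣ p q

subsetOfSize : ∀ {a} → a ≤ n → Σ (Subset n) λ p → ∣ p ∣ ≡ a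
subsetOfSize {n} z≤n = ⊥ , ∣⊥∣≡0 n
subsetOfSize (s≤s a≤n) with subsetOfSize a≤n
... | p , ∣p∣≡a = true ∷ p , cong suc ∣p∣≡a

allSubsets : (n : ℕ) → List (Subset n)
allSubsets zero    = [] ∷ []
allSubsets (suc n) = map (true ∷_) (allSubsets n) ++ map (false ∷_) (allSubsets n)

∈-allSubsets : (p : Subset n) → p List.∈ allSubsets n
∈-allSubsets []                  = Any.here refl
∈-allSubsets (true ∷ p)          = ∈-++⁺ˡ (∈-map⁺ (true ∷_) (∈-allSubsets p))
∈-allSubsets {suc n} (false ∷ p) = ∈-++⁺ʳ (map (true ∷_) (allSubsets n)) (∈-map⁺ (false ∷_) (∈-allSubsets p))

∣p∣≤length-filter : ∀ {a} {A : Set a} {P : Pred A a} (P? : Decidable P) (p : Subset n) (f : Fin n → A) →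
                    (∀ i → i ∈ p → P (f i)) → ∣ p ∣ ≤ length (filter P? (tabulate f))
∣p∣≤length-filter P? []      f Pf = z≤n
∣p∣≤length-filter P? (x ∷ p) f Pf with P? (f zero) | x
... | yes _  | true  = s≤s (∣p∣≤length-filter P? p (f ∘ suc) (λ i → Pf (suc i) ∘ there))
... | yes _  | false = m≤n⇒m≤1+n (∣p∣≤length-filter P? p (f ∘ suc) (λ i → Pf (suc i) ∘ there))
... | no ¬P₀ | true  = ⊥-elim (¬P₀ (Pf zero here))
... | no _   | false = ∣p∣≤length-filter P? p (f ∘ suc) (λ i → Pf (suc i) ∘ there)

sumOver : Subset n → (Fin n → ℕ) → ℕ
sumOver []          f = 0
sumOver (true ∷ p)  f = f zero + sumOver p (f ∘ suc)
sumOver (false ∷ p) f = sumOver p (f ∘ suc)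

sumOver-cong : (p : Subset n) {f g : Fin n → ℕ} → (∀ i → f i ≡ g i) → sumOver p f ≡ sumOver p g
sumOver-cong []          f≗g = refl
sumOver-cong (true ∷ p)  f≗g = cong₂ _+_ (f≗g zero) (sumOver-cong p (f≗g ∘ suc))
sumOver-cong (false ∷ p) f≗g = sumOver-cong p (f≗g ∘ suc)

sumOver-+ : (p : Subset n) (f g : Fin n → ℕ) → sumOver p (λ i → f i + g i) ≡ sumOver p f + sumOver p g
sumOver-+ []          f g = refl
sumOver-+ (false ∷ p) f g = sumOver-+ p (f ∘ suc) (g ∘ suc)
sumOver-+ (true ∷ p)  f g = begin
  (f zero + g zero) + sumOver p (λ i → f (suc i) + g (suc i))
    ≡⟨ cong (f zero + g zero +_) (sumOver-+ p (f ∘ suc) (g ∘ suc)) ⟩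
  (f zero + g zero) + (sumOver p (f ∘ suc) + sumOver p (g ∘ suc))
    ≡⟨ +-+-shuffle (f zero) (g zero) _ _ ⟩
  (f zero + sumOver p (f ∘ suc)) + (g zero + sumOver p (g ∘ suc)) ∎
  where
  open ≡-Reasoning
  +-+-shuffle : ∀ a b c d → (a + b) + (c + d) ≡ (a + c) + (b + d)
  +-+-shuffle = solve-∀

sumOver-mono : (p : Subset n) {f g : Fin n → ℕ} → (∀ i → i ∈ p → f i ≤ g i) → sumOver p f ≤ sumOver p g
sumOver-mono []          f≤g = z≤n
sumOver-mono (true ∷ p)  f≤g = +-mono-≤ (f≤g zero here) (sumOver-mono p (λ i → f≤g (suc i) ∘ there))
sumOver-mono (false ∷ p) f≤g = sumOver-mono p (λ i → f≤g (suc i) ∘ there)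

sumOver-const : (p : Subset n) (c : ℕ) → sumOver p (λ _ → c) ≡ ∣ p ∣ * c
sumOver-const []          c = refl
sumOver-const (true ∷ p)  c = cong (c +_) (sumOver-const p c)
sumOver-const (false ∷ p) c = sumOver-const p c

∣p∣≤sumOver : (p : Subset n) {f : Fin n → ℕ} → (∀ i → i ∈ p → 1 ≤ f i) → ∣ p ∣ ≤ sumOver p f
∣p∣≤sumOver p 1≤f = begin
  ∣ p ∣                ≡⟨ *-identityʳ ∣ p ∣ ⟨
  ∣ p ∣ * 1            ≡⟨ sumOver-const p 1 ⟨
  sumOver p (λ _ → 1)  ≤⟨ sumOver-mono p 1≤f ⟩
  sumOver p _          ∎
  where open ≤-Reasoning

sumOver≤∣p∣* : (p : Subset n) {f : Fin n → ℕ} {c : ℕ} → (∀ i → i ∈ p → f i ≤ c) → sumOver p f ≤ ∣ p ∣ * c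
sumOver≤∣p∣* p {c = c} f≤c = ≤-trans (sumOver-mono p f≤c) (≤-reflexive (sumOver-const p c))

indicator : Subset n → Fin n → ℕ
indicator e i = if does (i ∈? e) then 1 else 0

sumOver-indicator : (e p : Subset n) → sumOver p (indicator e) ≡ ∣ e ∩ p ∣
sumOver-indicator []          []          = refl
sumOver-indicator (true ∷ e)  (true ∷ p)  = cong suc (sumOver-indicator e p)
sumOver-indicator (true ∷ e)  (false ∷ p) = sumOver-indicator e p
sumOver-indicator (false ∷ e) (true ∷ p)  = sumOver-indicator e p
sumOver-indicator (false ∷ e) (false ∷ p) = sumOver-indicator e p

deg-∷ : (e : Subset n) (M : List (Subset n)) (i : Fin n) → deg (e ∷ M) i ≡ indicator e i + deg M i
deg-∷ e M i with does (i ∈? e)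
... | true  = refl
... | false = refl

incidences : Subset n → List (Subset n) → ℕ
incidences p M = sum (map (λ e → ∣ e ∩ p ∣) M)

sumOver-deg : (p : Subset n) (M : List (Subset n)) → sumOver p (deg M) ≡ incidences p M
sumOver-deg p []      = trans (sumOver-const p 0) (*-zeroʳ ∣ p ∣)
sumOver-deg p (e ∷ M) = begin
  sumOver p (deg (e ∷ M))                      ≡⟨ sumOver-cong p (deg-∷ e M) ⟩
  sumOver p (λ i → indicator e i + deg M i)    ≡⟨ sumOver-+ p (indicator e) (deg M) ⟩
  sumOver p (indicator e) + sumOver p (deg M)  ≡⟨ cong₂ _+_ (sumOver-indicator e p) (sumOver-deg p M) ⟩
  ∣ e ∩ p ∣ + incidences p M                   ∎
  where open ≡-Reasoning

incidences-mono : {p q : Subset n} (c : ℕ) {M : List (Subset n)} →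
                  All (λ e → ∣ e ∩ q ∣ ≤ c * ∣ e ∩ p ∣) M → incidences q M ≤ c * incidences p M
incidences-mono         c []                   = z≤n
incidences-mono {p = p} c {e ∷ M} (bound ∷ bounds) = begin
  ∣ e ∩ _ ∣ + incidences _ M             ≤⟨ +-mono-≤ bound (incidences-mono c bounds) ⟩
  c * ∣ e ∩ p ∣ + c * incidences p M     ≡⟨ *-distribˡ-+ c ∣ e ∩ p ∣ (incidences p M) ⟨
  c * incidences p (e ∷ M)               ∎
  where open ≤-Reasoning

[m+1]*k≡m*k+k : ∀ m k → (m + 1) * k ≡ m * k + k
[m+1]*k≡m*k+k = solve-∀

n≤[n∸s+1]*k : ∀ {n s k} → s ≤ n → s < k → n ≤ (n ∸ s + 1) * k
n≤[n∸s+1]*k {n} {s} {k} s≤n s<k = begin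
  n                      ≡⟨ m∸n+n≡m s≤n ⟨
  n ∸ s + s              ≤⟨ +-mono-≤ (≤-trans (≤-reflexive (sym (*-identityʳ (n ∸ s)))) (*-monoʳ-≤ (n ∸ s) 1≤k)) (<⇒≤ s<k) ⟩
  (n ∸ s) * k + k        ≡⟨ [m+1]*k≡m*k+k (n ∸ s) k ⟨
  (n ∸ s + 1) * k        ∎
  where
  open ≤-Reasoning
  1≤k : 1 ≤ k
  1≤k = ≤-<-trans z≤n s<k

s*[a*t]<n∸a : ∀ {n} a s t → a * (s * t + 1) < n → s * (a * t) < n ∸ a
s*[a*t]<n∸a {n} a s t a[st+1]<n = subst (_< n ∸ a) (m+n∸m≡n a (s * (a * t)))
  (∸-monoˡ-< (subst (_< n) (distribute a s t) a[st+1]<n) (m≤m+n a _))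
  where
  distribute : ∀ a s t → a * (s * t + 1) ≡ a + s * (a * t)
  distribute = solve-∀

divisionBounds : ∀ m k .{{_ : NonZero k}} → m / k * k ≤ m × suc m ≤ (m / k + 1) * k
divisionBounds m k = subst (m / k * k ≤_) (sym m≡r+qk) (m≤n+m _ _) , (begin
  suc m                    ≡⟨ cong suc m≡r+qk ⟩
  suc (m % k + m / k * k)  ≤⟨ +-monoˡ-≤ (m / k * k) (m%n<n m k) ⟩
  k + m / k * k            ≡⟨ +-comm k _ ⟩
  m / k * k + k            ≡⟨ [m+1]*k≡m*k+k (m / k) k ⟨
  (m / k + 1) * k          ∎)
  where
  open ≤-Reasoning
  m≡r+qk : m ≡ m % k + m / k * k
  m≡r+qk = m≡m%n+[m/n]*n m k

pivotSet : ∀ {n k} → 1 ≤ n → 1 ≤ k → Σ (Subset n) λ A → ∣ A ∣ * k < n × n ≤ (∣ A ∣ + 1) * k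
pivotSet {suc m} {k} _ 1≤k = proj₁ A , subst (λ a → a * k < suc m × suc m ≤ (a + 1) * k) (sym (proj₂ A))
                                                (s≤s qk≤m , 1+m≤[q+1]k)
  where
  instance
    k≢0 : NonZero k
    k≢0 = >-nonZero 1≤k
  qk≤m : m / k * k ≤ m
  qk≤m = proj₁ (divisionBounds m k)
  1+m≤[q+1]k : suc m ≤ (m / k + 1) * k
  1+m≤[q+1]k = proj₂ (divisionBounds m k)
  A : Σ (Subset (suc m)) λ A → ∣ A ∣ ≡ m / k
  A = subsetOfSize (m≤n⇒m≤1+n (≤-trans (m≤m*n (m / k) k) qk≤m))

hypergraphOf : {P : Pred (Subset n) 0ℓ} → Decidable P → Hypergraph n
hypergraphOf {n} P? = hypergraph (filter P? (allSubsets n))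

∣p∣≤codeg : {P : Pred (Subset n) 0ℓ} (P? : Decidable P) (ê p : Subset n) →
            (∀ v → v ∈ p → P (ê ∪ ⁅ v ⁆)) → ∣ p ∣ ≤ codeg (hypergraphOf P?) ê
∣p∣≤codeg {n} P? ê p P[ê∪v] = ∣p∣≤length-filter _ p id λ v v∈p →
  Any.map sym (∈-filter⁺ P? (∈-allSubsets (ê ∪ ⁅ v ⁆)) (P[ê∪v] v v∈p))

module Meeting (s : ℕ) (A : Subset n) where

  Meets : Pred (Subset n) 0ℓ
  Meets e = ∣ e ∣ ≡ suc s × Nonempty (e ∩ A)

  H : Hypergraph n
  H = hypergraphOf (λ e → (∣ e ∣ ≟ suc s) ×-dec nonempty? (e ∩ A))

  edges-meet : All Meets (edges H)
  edges-meet = all-filter _ (allSubsets n)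

  uniform : Uniform (suc s) H
  uniform = All.map proj₁ edges-meet

  ∣e∩∁A∣≤s*∣e∩A∣ : (e : Subset n) → Meets e → ∣ e ∩ ∁ A ∣ ≤ s * ∣ e ∩ A ∣
  ∣e∩∁A∣≤s*∣e∩A∣ e (∣e∣≡1+s , e∩A≢∅) = begin
    ∣ e ∩ ∁ A ∣      ≤⟨ ∣e∩∁A∣≤s ⟩
    s                ≡⟨ *-identityʳ s ⟨
    s * 1            ≤⟨ *-monoʳ-≤ s 1≤∣e∩A∣ ⟩
    s * ∣ e ∩ A ∣    ∎
    where
    open ≤-Reasoning
    1≤∣e∩A∣ : 1 ≤ ∣ e ∩ A ∣
    1≤∣e∩A∣ = nonempty⇒∣p∣>0 e∩A≢∅
    ∣e∩∁A∣≤s : ∣ e ∩ ∁ A ∣ ≤ s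
    ∣e∩∁A∣≤s = s≤s⁻¹ (subst (suc ∣ e ∩ ∁ A ∣ ≤_) (trans (∣p∩q∣+∣p∩∁q∣≡∣p∣ e A) ∣e∣≡1+s)
                                                 (+-monoˡ-≤ ∣ e ∩ ∁ A ∣ 1≤∣e∩A∣))

  ∣ê∪⁅v⁆∣≡1+s : {ê : Subset n} → ∣ ê ∣ ≡ s → (v : Fin n) → v ∉ ê → ∣ ê ∪ ⁅ v ⁆ ∣ ≡ suc s
  ∣ê∪⁅v⁆∣≡1+s {ê} ∣ê∣≡s v v∉ê = trans (x∉p⇒∣p∪⁅x⁆∣≡1+∣p∣ ê v v∉ê) (cong suc ∣ê∣≡s)

  codeg-bound : {k : ℕ} → s < k → n ≤ (∣ A ∣ + 1) * k →
                (ê : Subset n) → ∣ ê ∣ ≡ s → n ≤ (codeg H ê + 1) * k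
  codeg-bound {k} s<k n≤[∣A∣+1]*k ê ∣ê∣≡s with nonempty? (ê ∩ A)
  ... | yes ê∩A≢∅ = ≤-trans (n≤[n∸s+1]*k (subst (_≤ n) ∣ê∣≡s (∣p∣≤n ê)) s<k)
                            (*-monoˡ-≤ k (+-monoˡ-≤ 1 n∸s≤codeg))
    where
    extends : ∀ v → v ∈ ∁ ê → Meets (ê ∪ ⁅ v ⁆)
    extends v v∈∁ê = ∣ê∪⁅v⁆∣≡1+s ∣ê∣≡s v (x∈∁p⇒x∉p v∈∁ê) ,
      let (x , x∈ê∩A) = ê∩A≢∅ ; (x∈ê , x∈A) = x∈p∩q⁻ ê A x∈ê∩A in x , x∈p∩q⁺ (p⊆p∪q ⁅ v ⁆ x∈ê , x∈A)
    n∸s≤codeg : n ∸ s ≤ codeg H ê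
    n∸s≤codeg = subst (_≤ codeg H ê) (trans (∣∁p∣≡n∸∣p∣ ê) (cong (n ∸_) ∣ê∣≡s)) (∣p∣≤codeg _ ê (∁ ê) extends)
  ... | no ê∩A≡∅ = ≤-trans n≤[∣A∣+1]*k (*-monoˡ-≤ k (+-monoˡ-≤ 1 (∣p∣≤codeg _ ê A extends)))
    where
    extends : ∀ v → v ∈ A → Meets (ê ∪ ⁅ v ⁆)
    extends v v∈A = ∣ê∪⁅v⁆∣≡1+s ∣ê∣≡s v (λ v∈ê → ê∩A≡∅ (v , x∈p∩q⁺ (v∈ê , v∈A))) ,
                    v , x∈p∩q⁺ (x∈p∪q⁺ (inj₂ (x∈⁅x⁆ v)) , v∈A)

  no-shallow-hitting : (t : ℕ) → s * (∣ A ∣ * t) < ∣ ∁ A ∣ →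
    ¬ (Σ (List (Subset n)) λ M → EdgeSubset M H × Hitting M × Shallow t M)
  no-shallow-hitting t few (M , M⊆E , hitting , shallow) = <⇒≱ few (begin
    ∣ ∁ A ∣                  ≤⟨ ∣p∣≤sumOver (∁ A) (λ v _ → hitting v) ⟩
    sumOver (∁ A) (deg M)    ≡⟨ sumOver-deg (∁ A) M ⟩
    incidences (∁ A) M       ≤⟨ incidences-mono s (All.map (λ {e} → ∣e∩∁A∣≤s*∣e∩A∣ e) (All-resp-⊆ M⊆E edges-meet)) ⟩
    s * incidences A M       ≡⟨ cong (s *_) (sumOver-deg A M) ⟨
    s * sumOver A (deg M)    ≤⟨ *-monoʳ-≤ s (sumOver≤∣p∣* A (λ v _ → shallow v)) ⟩
    s * (∣ A ∣ * t)          ∎)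
    where open ≤-Reasoning

theorem4p2 : (r t n : ℕ) → 2 ≤ r → 2 ≤ t → 1 ≤ n →
    Σ (Hypergraph n) λ H →
      Uniform r H ×
      ((ê : Subset n) → ∣ ê ∣ ≡ r ∸ 1 →
         n ≤ (codeg H ê + 1) * ((r ∸ 1) * t + 1)) ×
      ¬ (Σ (List (Subset n)) λ M → EdgeSubset M H × Hitting M × Shallow t M)
theorem4p2 (suc s) t@(suc _) n (s≤s _) (s≤s _) 1≤n with pivotSet 1≤n (m≤n+m 1 (s * t))
... | A , ∣A∣k<n , n≤[∣A∣+1]k =
  H , uniform , codeg-bound s<st+1 n≤[∣A∣+1]k ,
  no-shallow-hitting t (subst (s * (∣ A ∣ * t) <_) (sym (∣∁p∣≡n∸∣p∣ A)) (s*[a*t]<n∸a ∣ A ∣ s t ∣A∣k<n))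
  where
  open Meeting s A
  s<st+1 : s < s * t + 1
  s<st+1 = subst (s <_) (+-comm 1 (s * t)) (s≤s (m≤m*n s t))
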